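{- Let $p, q$ be prime numbers and $n, m$ natural numbers such that $Cl_2(\mathbb{Z}_{p^n}) \cong Cl_2(\mathbb{Z}_{q^m})$. Then for every natural number $k$, $Cl_2(\mathbb{Z}_{p^n} \times \mathbb{Z}_k) \cong Cl_2(\mathbb{Z}_{q^m} \times \mathbb{Z}_k)$.
   Context: For a ring $R$ with identity, $Id(R)$ denotes the set of idempotents and $U(R)$ the set of units of $R$. The clean graph $Cl(R)$ has vertex set $Id(R) \times U(R)$, and two distinct vertices $(e,u)$ and $(f,v)$ are adjacent if and only if $ef=fe=0$ or $uv=vu=1$. $Cl_2(R)$ is the induced subgraph of $Cl(R)$ on $\{(e,u): e \in Id(R)\setminus\{0\},\ u \in U(R)\}$. $\mathbb{Z}_{p^n} \times \mathbb{Z}_k$ is the direct product ring. $\cong$ denotes graph isomorphism. -}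

module Defs where

open import Data.Nat using (ℕ; NonZero)
import Data.Nat as ℕ
open import Data.Nat.Properties using (m^n≢0)
open import Data.Nat.DivMod using (_mod_)
open import Data.Nat.Primality using (Prime; prime⇒nonZero)
open import Data.Fin using (Fin; toℕ)
import Data.Fin.Properties as FinP
open import Data.Product using (Σ; Σ-syntax; _×_; _,_)
import Data.Product.Properties as ProdP
open import Data.Sum using (_⊎_)
open import Relation.Binary.PropositionalEquality using (_≡_; _≢_)
open import Relation.Binary.Definitions using (DecidableEquality)
open import Relation.Nullary.Decidable using (False)
open import Function.Bundles using (_⤖_; _⇔_; Bijection)
open import Function.Base using (_on_)

-- The multiplicative data of a ring with identity (enough to define Id, U and Cl₂).
record RingData : Set₁ where
  field
    Carrier : Set
    _≟_     : DecidableEquality Carrier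
    _*_     : Carrier → Carrier → Carrier
    0#      : Carrier
    1#      : Carrier

ℤ/ : (N : ℕ) → .{{NonZero N}} → RingData
ℤ/ N = record
  { Carrier = Fin N
  ; _≟_ = FinP._≟_
  ; _*_ = λ a b → (toℕ a ℕ.* toℕ b) mod N
  ; 0# = 0 mod N
  ; 1# = 1 mod N
  }

ℤ/pow : (p : ℕ) → Prime p → (n : ℕ) → RingData
ℤ/pow p pp n = ℤ/ (p ℕ.^ n) {{m^n≢0 p n {{prime⇒nonZero pp}}}}

_×R_ : RingData → RingData → RingData
R ×R S = record
  { Carrier = R.Carrier × S.Carrier
  ; _≟_ = ProdP.≡-dec R._≟_ S._≟_
  ; _*_ = λ { (a , b) (c , d) → (a R.* c) , (b S.* d) }
  ; 0# = R.0# , S.0#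
  ; 1# = R.1# , S.1#
  }
  where
  module R = RingData R
  module S = RingData S

record Graph : Set₁ where
  field
    V   : Set
    Adj : V → V → Set

_≅_ : Graph → Graph → Set
G ≅ H = Σ[ φ ∈ (G.V ⤖ H.V) ] (∀ x y → G.Adj x y ⇔ H.Adj (Bijection.to φ x) (Bijection.to φ y))
  where
  module G = Graph G
  module H = Graph H

module _ (R : RingData) where
  open RingData R

  IsIdempotent : Carrier → Set
  IsIdempotent e = e * e ≡ e

  IsUnit : Carrier → Set
  IsUnit u = Σ[ v ∈ Carrier ] (u * v ≡ 1#) × (v * u ≡ 1#)

  Cl₂Vertex : Set
  Cl₂Vertex = Σ[ e ∈ Carrier ] Σ[ u ∈ Carrier ]
                (IsIdempotent e × False (e ≟ 0#) × IsUnit u)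

  Cl₂Adj : Cl₂Vertex → Cl₂Vertex → Set
  Cl₂Adj (e , u , _) (f , v , _) =
    ((e , u) ≢ (f , v)) ×
    (((e * f ≡ 0#) × (f * e ≡ 0#)) ⊎ ((u * v ≡ 1#) × (v * u ≡ 1#)))

  Cl₂ : Graph
  Cl₂ = record { V = Cl₂Vertex ; Adj = Cl₂Adj }

{-# OPTIONS --safe #-}
-- Cl₂ R depends only on two graphs attached to R: the idempotents, adjacent when orthogonal,
-- and the units, adjacent when mutually inverse. For a product R × T both graphs are the
-- tensor products of those of R and T, so it suffices that ℤ/p^n and ℤ/q^m have isomorphic
-- idempotent and unit graphs. Both rings are connected (p^n ∣ e(e − 1) forces e ∈ {0, 1}, as
-- p cannot divide both factors), so their idempotent graphs are the same two-vertex graph, and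
-- Cl₂ is their unit graph with the loops (the self-inverse units) deleted. Inversion is an
-- involution, so the loops can be recovered: a unit is self-inverse exactly when it is
-- isolated in Cl₂. Hence Cl₂(ℤ/p^n) ≅ Cl₂(ℤ/q^m) yields an isomorphism of the unit graphs.
module Submission where

open import Defs

open import Algebra.Definitions using (Zero)
open import Algebra.Structures using (IsMonoid)
open import Axiom.UniquenessOfIdentityProofs using (UIP; module Decidable⇒UIP)
open import Data.Bool using (Bool; true; false; _∧_)
open import Data.Bool.Properties using (T-irrelevant)
open import Data.Empty using (⊥-elim; ⊥-elim-irr)
open import Data.Fin using (toℕ)
open import Data.Fin.Properties using (toℕ-fromℕ<; toℕ-injective; toℕ<n)
open import Data.Nat as ℕ
  using (ℕ; NonZero; _≤_; zero; suc; _+_; _^_; _%_; _/_; _<_; nonTrivial⇒≢1; nonTrivial⇒n>1)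
import Data.Nat.Properties as ℕ
open import Data.Nat.DivMod using (_mod_; m%n<n; m<n⇒m%n≡m; m%n%n≡m%n; %-distribˡ-*; m≡m%n+[m/n]*n)
open import Data.Nat.Divisibility
  using (_∣_; divides; _∣?_; ∣-trans; m∣m*n; 1∣_; ∣1⇒≡1; ∣m+n∣m⇒∣n; *-monoʳ-∣; *-cancelˡ-∣; >⇒∤)
open import Data.Nat.Primality using (Prime; euclidsLemma; prime⇒nonZero; prime⇒nonTrivial)
open import Data.Product using (Σ; ∃; _×_; _,_; proj₁; proj₂; map; map₁)
open import Data.Product.Function.NonDependent.Propositional using (_×-⇔_)
open import Data.Sum as Sum using (_⊎_; inj₁; inj₂; [_,_])
open import Data.Sum.Function.Propositional using (_⊎-⇔_)
open import Function.Base using (_∘_; id; const)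
open import Function.Bundles using (_⤖_; _⇔_; Bijection; Equivalence; Inverse; mk⇔; mk⤖; mk↔ₛ′)
open import Function.Consequences.Propositional using (strictlySurjective⇒surjective)
open import Function.Construct.Composition using (_⤖-∘_)
open import Function.Properties.Bijection using (⤖⇒↔)
import Function.Properties.Equivalence as ⇔
open import Function.Properties.Inverse using (↔⇒⤖)
open import Relation.Binary.Definitions using (DecidableEquality)
open import Relation.Binary.PropositionalEquality
  using (_≡_; _≢_; refl; sym; trans; cong; cong₂; subst; subst₂; isEquivalence; module ≡-Reasoning)
import Relation.Binary.Reasoning.Base.Single as Single
open import Relation.Binary.Reasoning.Syntax using (module ≃-syntax)
open import Relation.Nullary using (¬_; yes; no)
open import Relation.Nullary.Decidable using (map′; fromWitnessFalse; toWitnessFalse)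
open import Relation.Nullary.Recomputable using (¬-recompute)
open import Relation.Unary using (Irrelevant)

open Graph using (V; Adj)

-- Isomorphisms of graphs

-- Since _≅_ unfolds to a Σ-type, Agda cannot infer its graph arguments from it; they are
-- therefore often given explicitly below.
mk≅ : {G H : Graph} (to : V G → V H) (from : V H → V G) →
      (∀ y → to (from y) ≡ y) → (∀ x → from (to x) ≡ x) →
      (∀ x y → Adj G x y ⇔ Adj H (to x) (to y)) → G ≅ H
mk≅ to from to∘from from∘to adjacency =
  ↔⇒⤖ (mk↔ₛ′ to from to∘from from∘to) , adjacency

≢-⇔ : {A B : Set} (f : A ⤖ B) {x y : A} →
      x ≢ y ⇔ Bijection.to f x ≢ Bijection.to f y
≢-⇔ f = mk⇔ (λ x≢y → x≢y ∘ Bijection.injective f) (λ fx≢fy → fx≢fy ∘ cong (Bijection.to f))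

module Iso {G H : Graph} (φ : G ≅ H) where
  open Inverse (⤖⇒↔ (proj₁ φ)) public using (to; from; strictlyInverseˡ; strictlyInverseʳ)

  adjacency : ∀ x y → Adj G x y ⇔ Adj H (to x) (to y)
  adjacency = proj₂ φ

  adjacency⁻¹ : ∀ x y → Adj H x y ⇔ Adj G (from x) (from y)
  adjacency⁻¹ x y = ⇔.sym (subst₂ (λ a b → Adj G (from x) (from y) ⇔ Adj H a b)
    (strictlyInverseˡ x) (strictlyInverseˡ y) (adjacency (from x) (from y)))

≅-refl : {G : Graph} → G ≅ G
≅-refl {G} = mk≅ {G} {G} id id (λ _ → refl) (λ _ → refl) (λ _ _ → ⇔.refl)

≅-sym : {G H : Graph} → G ≅ H → H ≅ G
≅-sym {G} {H} φ = mk≅ {H} {G} from to strictlyInverseʳ strictlyInverseˡ adjacency⁻¹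
  where open Iso {G} {H} φ

≅-trans : {G H K : Graph} → G ≅ H → H ≅ K → G ≅ K
≅-trans (f , f-adj) (g , g-adj) = g ⤖-∘ f , λ x y → ⇔.trans (f-adj x y) (g-adj _ _)

module ≅-Reasoning where
  private
    module Base = Single _≅_ ≅-refl (λ {G H K} → ≅-trans {G} {H} {K})

  open Base public using (begin_; _∎)
  open ≃-syntax Base._IsRelatedTo_ Base._IsRelatedTo_ Base.∼-go (λ {G H} → ≅-sym {G} {H}) public

-- Functional graphs and their loopless parts

Loopless : Graph → Graph
Loopless G = record { V = V G ; Adj = λ x y → x ≢ y × Adj G x y }

record IsFunctional (G : Graph) : Set where
  field
    image  : ∀ x → ∃ (Adj G x)
    unique : ∀ {x y z} → Adj G x y → Adj G x z → y ≡ z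

module _ {G H : Graph} (φ : Loopless G ≅ Loopless H) where
  open Iso {Loopless G} {Loopless H} φ

  -- A neighbour y ≢ x of x would give to x the two distinct neighbours to x and to y.
  loop-reflected : DecidableEquality (V G) → IsFunctional G → IsFunctional H →
                   ∀ x → Adj H (to x) (to x) → Adj G x x
  loop-reflected _≟_ G-functional H-functional x loop with IsFunctional.image G-functional x
  ... | y , x~y with y ≟ x
  ...   | yes refl = x~y
  ...   | no y≢x =
    ⊥-elim (proj₁ image-edge (IsFunctional.unique H-functional loop (proj₂ image-edge)))
    where
    image-edge = Equivalence.to (adjacency x y) (y≢x ∘ sym , x~y)

Loopless-cancel : {G H : Graph} → DecidableEquality (V G) → DecidableEquality (V H) →
                  IsFunctional G → IsFunctional H → Loopless G ≅ Loopless H → G ≅ H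
Loopless-cancel {G} {H} _≟G_ _≟H_ G-functional H-functional φ =
  proj₁ φ , λ x y → mk⇔ (preserve x y) (reflect x y)
  where
  open Iso {Loopless G} {Loopless H} φ

  reflect : ∀ x y → Adj H (to x) (to y) → Adj G x y
  reflect x y x~y with x ≟G y
  ... | yes refl = loop-reflected φ _≟G_ G-functional H-functional x x~y
  ... | no x≢y = proj₂ (Equivalence.from (adjacency x y) (Equivalence.to (≢-⇔ (proj₁ φ)) x≢y , x~y))

  preserve : ∀ x y → Adj G x y → Adj H (to x) (to y)
  preserve x y x~y with x ≟G y
  ... | yes refl = loop-reflected (≅-sym {Loopless G} {Loopless H} φ) _≟H_
                     H-functional G-functional (to x)
                     (subst (λ z → Adj G z z) (sym (strictlyInverseʳ x)) x~y)
  ... | no x≢y = proj₂ (Equivalence.to (adjacency x y) (x≢y , x~y))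

-- Tensor products and clean graphs

infixr 25 _⊠_

_⊠_ : Graph → Graph → Graph
G ⊠ H = record
  { V   = V G × V H
  ; Adj = λ x y → Adj G (proj₁ x) (proj₁ y) × Adj H (proj₂ x) (proj₂ y)
  }

⊠-cong : {G G′ H H′ : Graph} → G ≅ G′ → H ≅ H′ → G ⊠ H ≅ G′ ⊠ H′
⊠-cong {G} {G′} {H} {H′} φ ψ = mk≅ {G ⊠ H} {G′ ⊠ H′} (map φ.to ψ.to) (map φ.from ψ.from)
  (λ (x , y) → cong₂ _,_ (φ.strictlyInverseˡ x) (ψ.strictlyInverseˡ y))
  (λ (x , y) → cong₂ _,_ (φ.strictlyInverseʳ x) (ψ.strictlyInverseʳ y))
  (λ x y → φ.adjacency _ _ ×-⇔ ψ.adjacency _ _)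
  where
  module φ = Iso {G} {G′} φ
  module ψ = Iso {H} {H′} ψ

-- Cl₂ R in terms of the idempotent graph I and the unit graph U of R (see Cl₂≅Clean). As
-- e * e ≡ e, an idempotent is orthogonal to itself exactly when it is 0, so nonzero says e ≢ 0;
-- it is irrelevant so that equality of vertices needs no function extensionality.
record CleanVertex (I U : Graph) : Set where
  constructor vertex
  field
    idempotent : V I
    unit       : V U
    .nonzero   : ¬ Adj I idempotent idempotent

open CleanVertex using (idempotent; unit)

Clean : Graph → Graph → Graph
Clean I U = record
  { V   = CleanVertex I U
  ; Adj = λ x y → x ≢ y × (Adj I (idempotent x) (idempotent y) ⊎ Adj U (unit x) (unit y))
  }

CleanVertex-≡ : {I U : Graph} {x y : CleanVertex I U} →
                idempotent x ≡ idempotent y → unit x ≡ unit y → x ≡ y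
CleanVertex-≡ {x = vertex _ _ _} {vertex _ _ _} refl refl = refl

Clean-cong : {I I′ U U′ : Graph} → I ≅ I′ → U ≅ U′ → Clean I U ≅ Clean I′ U′
Clean-cong {I} {I′} {U} {U′} φ ψ = bijection , λ x y →
  ≢-⇔ bijection ×-⇔ (φ.adjacency _ _ ⊎-⇔ ψ.adjacency _ _)
  where
  module φ = Iso {I} {I′} φ
  module ψ = Iso {U} {U′} ψ

  to : CleanVertex I U → CleanVertex I′ U′
  to (vertex i u i≢0) = vertex (φ.to i) (ψ.to u) (i≢0 ∘ Equivalence.from (φ.adjacency i i))

  from : CleanVertex I′ U′ → CleanVertex I U
  from (vertex i u i≢0) = vertex (φ.from i) (ψ.from u) (i≢0 ∘ Equivalence.from (φ.adjacency⁻¹ i i))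

  bijection : CleanVertex I U ⤖ CleanVertex I′ U′
  bijection = ↔⇒⤖ (mk↔ₛ′ to from
    (λ x → CleanVertex-≡ (φ.strictlyInverseˡ (idempotent x)) (ψ.strictlyInverseˡ (unit x)))
    (λ x → CleanVertex-≡ (φ.strictlyInverseʳ (idempotent x)) (ψ.strictlyInverseʳ (unit x))))

-- The idempotent graph of a connected ring, with false and true standing for 0 and 1.
𝟚 : Graph
𝟚 = record { V = Bool ; Adj = λ a b → a ∧ b ≡ false }

Clean-𝟚 : {U : Graph} → Clean 𝟚 U ≅ Loopless U
Clean-𝟚 {U} = mk≅ {Clean 𝟚 U} {Loopless U} unit from (λ _ → refl) from∘to adjacency
  where
  from : V U → CleanVertex 𝟚 U
  from u = vertex true u λ ()

  from∘to : ∀ x → from (unit x) ≡ x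
  from∘to (vertex true  _ _)   = refl
  from∘to (vertex false _ 0≢0) = ⊥-elim-irr (0≢0 refl)

  adjacency : ∀ x y → Adj (Clean 𝟚 U) x y ⇔ Adj (Loopless U) (unit x) (unit y)
  adjacency (vertex false _ 0≢0) _ = ⊥-elim-irr (0≢0 refl)
  adjacency (vertex true _ _) (vertex false _ 0≢0) = ⊥-elim-irr (0≢0 refl)
  adjacency (vertex true u _) (vertex true v _) = mk⇔
    (λ (x≢y , x~y) → x≢y ∘ cong from , [ (λ ()) , id ] x~y)
    (λ (u≢v , u~v) → u≢v ∘ cong unit , inj₂ u~v)

-- Idempotent and unit graphs of a ring

module _ (R : RingData) where
  open RingData R

  TwoSided : Carrier → Carrier → Carrier → Set
  TwoSided c a b = (a * b ≡ c) × (b * a ≡ c)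

  MulGraph : (Carrier → Set) → Carrier → Graph
  MulGraph P c = record { V = Σ Carrier P ; Adj = λ x y → TwoSided c (proj₁ x) (proj₁ y) }

  IdempotentGraph : Graph
  IdempotentGraph = MulGraph (IsIdempotent R) 0#

  UnitGraph : Graph
  UnitGraph = MulGraph (IsUnit R) 1#

  InversesUnique : Set
  InversesUnique = ∀ {u v w} → u * v ≡ 1# → w * u ≡ 1# → v ≡ w

  monoid⇒inversesUnique : IsMonoid _≡_ _*_ 1# → InversesUnique
  monoid⇒inversesUnique isMonoid {u} {v} {w} uv≡1 wu≡1 = begin
    v            ≡⟨ sym (identityˡ v) ⟩
    1# * v       ≡⟨ cong (_* v) wu≡1 ⟨
    (w * u) * v  ≡⟨ assoc w u v ⟩
    w * (u * v)  ≡⟨ cong (w *_) uv≡1 ⟩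
    w * 1#       ≡⟨ identityʳ w ⟩
    w            ∎
    where
    open IsMonoid isMonoid using (assoc; identityˡ; identityʳ)
    open ≡-Reasoning

  ≡-irrelevant : UIP Carrier
  ≡-irrelevant = Decidable⇒UIP.≡-irrelevant _≟_

  isIdempotent-irrelevant : Irrelevant (IsIdempotent R)
  isIdempotent-irrelevant = ≡-irrelevant

  isUnit-irrelevant : InversesUnique → Irrelevant (IsUnit R)
  isUnit-irrelevant unique (v , uv , vu) (w , uw , wu) with unique uv wu
  ... | refl = cong₂ (λ p q → v , p , q) (≡-irrelevant uv uw) (≡-irrelevant vu wu)

  subtype-≡ : {P : Carrier → Set} → Irrelevant P → {x y : Σ Carrier P} → proj₁ x ≡ proj₁ y → x ≡ y
  subtype-≡ irrelevant {x , p} {.x , q} refl = cong (x ,_) (irrelevant p q)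

  unit-≟ : InversesUnique → DecidableEquality (V UnitGraph)
  unit-≟ unique x y = map′ (subtype-≡ (isUnit-irrelevant unique)) (cong proj₁) (proj₁ x ≟ proj₁ y)

  UnitGraph-isFunctional : InversesUnique → IsFunctional UnitGraph
  UnitGraph-isFunctional unique = record
    { image  = λ (u , v , uv , vu) → (v , u , vu , uv) , uv , vu
    ; unique = λ (uv , _) (_ , wu) → subtype-≡ (isUnit-irrelevant unique) (unique uv wu)
    }

  self-orthogonal⇔≡0 : ∀ {e} → IsIdempotent R e → TwoSided 0# e e ⇔ e ≡ 0#
  self-orthogonal⇔≡0 ee≡e = mk⇔
    (λ (ee≡0 , _) → trans (sym ee≡e) ee≡0)
    (λ e≡0 → trans ee≡e e≡0 , trans ee≡e e≡0)

  label : Cl₂Vertex R → Carrier × Carrier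
  label (e , u , _) = e , u

  Cl₂Vertex-≡ : InversesUnique → {x y : Cl₂Vertex R} → label x ≡ label y → x ≡ y
  Cl₂Vertex-≡ unique {e , u , ee , e≢0 , U} {.e , .u , ee′ , e≢0′ , U′} refl
    rewrite isIdempotent-irrelevant ee ee′ | T-irrelevant e≢0 e≢0′ | isUnit-irrelevant unique U U′
    = refl

  Cl₂≅Clean : InversesUnique → Cl₂ R ≅ Clean IdempotentGraph UnitGraph
  Cl₂≅Clean unique = ↔⇒⤖ (mk↔ₛ′ to from (λ _ → refl) (λ _ → Cl₂Vertex-≡ unique refl)) , λ x y → mk⇔
    (map₁ λ x≢y tx≡ty → x≢y (cong (label ∘ from) tx≡ty))
    (map₁ λ tx≢ty x≡y → tx≢ty (cong to (Cl₂Vertex-≡ unique {x} {y} x≡y)))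
    where
    to : Cl₂Vertex R → CleanVertex IdempotentGraph UnitGraph
    to (e , u , ee , e≢0 , U) =
      vertex (e , ee) (u , U) (toWitnessFalse e≢0 ∘ Equivalence.to (self-orthogonal⇔≡0 ee))

    from : CleanVertex IdempotentGraph UnitGraph → Cl₂Vertex R
    from (vertex (e , ee) (u , U) e≢0) =
      e , u , ee , fromWitnessFalse (¬-recompute e≢0 ∘ Equivalence.from (self-orthogonal⇔≡0 ee)) , U

×-inversesUnique : (R T : RingData) → InversesUnique R → InversesUnique T → InversesUnique (R ×R T)
×-inversesUnique R T R-unique T-unique uv≡1 wu≡1 =
  cong₂ _,_ (R-unique (cong proj₁ uv≡1) (cong proj₁ wu≡1))
            (T-unique (cong proj₂ uv≡1) (cong proj₂ wu≡1))

module _ (R T : RingData) where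
  module R = RingData R
  module T = RingData T

  TwoSided-× : ∀ {a b a′ b′ c d} →
               TwoSided (R ×R T) (c , d) (a , b) (a′ , b′) ⇔ (TwoSided R c a a′ × TwoSided T d b b′)
  TwoSided-× = mk⇔
    (λ (p , q) → (cong proj₁ p , cong proj₁ q) , (cong proj₂ p , cong proj₂ q))
    (λ ((p , q) , (p′ , q′)) → cong₂ _,_ p p′ , cong₂ _,_ q q′)

  MulGraph-× : {P : R.Carrier → Set} {Q : T.Carrier → Set} {PQ : R.Carrier × T.Carrier → Set} →
               Irrelevant P → Irrelevant Q → Irrelevant PQ → (∀ {a b} → PQ (a , b) ⇔ (P a × Q b)) →
               ∀ {c d} → MulGraph (R ×R T) PQ (c , d) ≅ MulGraph R P c ⊠ MulGraph T Q d
  MulGraph-× {P} {Q} {PQ} P-irrelevant Q-irrelevant PQ-irrelevant split {c} {d} =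
    mk≅ {MulGraph (R ×R T) PQ (c , d)} {MulGraph R P c ⊠ MulGraph T Q d} to from
      (λ (x , y) → cong₂ _,_ (subtype-≡ R P-irrelevant refl) (subtype-≡ T Q-irrelevant refl))
      (λ _ → subtype-≡ (R ×R T) PQ-irrelevant refl)
      (λ _ _ → TwoSided-×)
    where
    to : Σ (R.Carrier × T.Carrier) PQ → Σ R.Carrier P × Σ T.Carrier Q
    to ((a , b) , pq) = map (a ,_) (b ,_) (Equivalence.to split pq)

    from : Σ R.Carrier P × Σ T.Carrier Q → Σ (R.Carrier × T.Carrier) PQ
    from ((a , p) , (b , q)) = (a , b) , Equivalence.from split (p , q)

  isIdempotent-× : ∀ {a b} → IsIdempotent (R ×R T) (a , b) ⇔ (IsIdempotent R a × IsIdempotent T b)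
  isIdempotent-× = mk⇔ (λ p → cong proj₁ p , cong proj₂ p) (λ (p , q) → cong₂ _,_ p q)

  isUnit-× : ∀ {a b} → IsUnit (R ×R T) (a , b) ⇔ (IsUnit R a × IsUnit T b)
  isUnit-× = mk⇔
    (λ ((v , w) , inverse) → map (v ,_) (w ,_) (Equivalence.to TwoSided-× inverse))
    (λ ((v , i) , (w , j)) → (v , w) , Equivalence.from TwoSided-× (i , j))

  Cl₂-× : InversesUnique R → InversesUnique T →
          Cl₂ (R ×R T) ≅ Clean (IdempotentGraph R ⊠ IdempotentGraph T) (UnitGraph R ⊠ UnitGraph T)
  Cl₂-× R-unique T-unique = begin
    Cl₂ (R ×R T)
      ≃⟨ Cl₂≅Clean (R ×R T) RT-unique ⟩
    Clean (IdempotentGraph (R ×R T)) (UnitGraph (R ×R T))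
      ≃⟨ Clean-cong
           (MulGraph-× (isIdempotent-irrelevant R) (isIdempotent-irrelevant T)
                       (isIdempotent-irrelevant (R ×R T)) isIdempotent-×)
           (MulGraph-× (isUnit-irrelevant R R-unique) (isUnit-irrelevant T T-unique)
                       (isUnit-irrelevant (R ×R T) RT-unique) isUnit-×) ⟩
    Clean (IdempotentGraph R ⊠ IdempotentGraph T) (UnitGraph R ⊠ UnitGraph T)
      ∎
    where
    open ≅-Reasoning
    RT-unique = ×-inversesUnique R T R-unique T-unique

Cl₂-×-congˡ : (R S T : RingData) → InversesUnique R → InversesUnique S → InversesUnique T →
              IdempotentGraph R ≅ IdempotentGraph S → UnitGraph R ≅ UnitGraph S →
              Cl₂ (R ×R T) ≅ Cl₂ (S ×R T)
Cl₂-×-congˡ R S T R-unique S-unique T-unique idempotents units = begin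
  Cl₂ (R ×R T)
    ≃⟨ Cl₂-× R T R-unique T-unique ⟩
  Clean (IdempotentGraph R ⊠ IdempotentGraph T) (UnitGraph R ⊠ UnitGraph T)
    ≃⟨ Clean-cong (⊠-cong {G′ = IdempotentGraph S} {H′ = IdempotentGraph T} idempotents ≅-refl)
                  (⊠-cong {G′ = UnitGraph S} {H′ = UnitGraph T} units ≅-refl) ⟩
  Clean (IdempotentGraph S ⊠ IdempotentGraph T) (UnitGraph S ⊠ UnitGraph T)
    ≃⟨ Cl₂-× S T S-unique T-unique ⟨
  Cl₂ (S ×R T)
    ∎
  where open ≅-Reasoning

-- Connected rings

record IsConnected (R : RingData) : Set where
  open RingData R
  field
    isMonoid       : IsMonoid _≡_ _*_ 1#
    *-zero         : Zero _≡_ 0# _*_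
    1≢0            : 1# ≢ 0#
    idempotent⇒0⊎1 : ∀ {e} → e * e ≡ e → e ≡ 0# ⊎ e ≡ 1#

  inversesUnique : InversesUnique R
  inversesUnique = monoid⇒inversesUnique R isMonoid

module _ {R : RingData} (connected : IsConnected R) where
  open RingData R
  open IsConnected connected
  open IsMonoid isMonoid using (identityˡ)

  bit : Bool → V (IdempotentGraph R)
  bit false = 0# , proj₁ *-zero 0#
  bit true  = 1# , identityˡ 1#

  bit-injective : ∀ {a b} → bit a ≡ bit b → a ≡ b
  bit-injective {false} {false} _  = refl
  bit-injective {false} {true}  eq = ⊥-elim (1≢0 (sym (cong proj₁ eq)))
  bit-injective {true}  {false} eq = ⊥-elim (1≢0 (cong proj₁ eq))
  bit-injective {true}  {true}  _  = refl

  bit-surjective : ∀ e → ∃ λ a → bit a ≡ e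
  bit-surjective (e , ee≡e) with idempotent⇒0⊎1 ee≡e
  ... | inj₁ e≡0 = false , subtype-≡ R (isIdempotent-irrelevant R) (sym e≡0)
  ... | inj₂ e≡1 = true  , subtype-≡ R (isIdempotent-irrelevant R) (sym e≡1)

  bit-orthogonal : ∀ a b → a ∧ b ≡ false ⇔ TwoSided R 0# (proj₁ (bit a)) (proj₁ (bit b))
  bit-orthogonal false false = mk⇔ (const (proj₁ *-zero 0# , proj₁ *-zero 0#)) (const refl)
  bit-orthogonal false true  = mk⇔ (const (proj₁ *-zero 1# , proj₂ *-zero 1#)) (const refl)
  bit-orthogonal true  false = mk⇔ (const (proj₂ *-zero 1# , proj₁ *-zero 1#)) (const refl)
  bit-orthogonal true  true  =
    mk⇔ (λ ()) (λ (1·1≡0 , _) → ⊥-elim (1≢0 (trans (sym (identityˡ 1#)) 1·1≡0)))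

  𝟚≅IdempotentGraph : 𝟚 ≅ IdempotentGraph R
  𝟚≅IdempotentGraph =
    mk⤖ (bit-injective , strictlySurjective⇒surjective bit-surjective) , bit-orthogonal

  Cl₂≅Loopless : Cl₂ R ≅ Loopless (UnitGraph R)
  Cl₂≅Loopless = begin
    Cl₂ R                                    ≃⟨ Cl₂≅Clean R inversesUnique ⟩
    Clean (IdempotentGraph R) (UnitGraph R)  ≃⟨ Clean-cong 𝟚≅IdempotentGraph ≅-refl ⟨
    Clean 𝟚 (UnitGraph R)                    ≃⟨ Clean-𝟚 ⟩
    Loopless (UnitGraph R)                   ∎
    where open ≅-Reasoning

module _ {R S : RingData} (R-connected : IsConnected R) (S-connected : IsConnected S) where
  open IsConnected R-connected using () renaming (inversesUnique to R-unique)
  open IsConnected S-connected using () renaming (inversesUnique to S-unique)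

  connected⇒IdempotentGraph-≅ : IdempotentGraph R ≅ IdempotentGraph S
  connected⇒IdempotentGraph-≅ = begin
    IdempotentGraph R  ≃⟨ 𝟚≅IdempotentGraph R-connected ⟨
    𝟚                  ≃⟨ 𝟚≅IdempotentGraph S-connected ⟩
    IdempotentGraph S  ∎
    where open ≅-Reasoning

  Cl₂-≅⇒UnitGraph-≅ : Cl₂ R ≅ Cl₂ S → UnitGraph R ≅ UnitGraph S
  Cl₂-≅⇒UnitGraph-≅ φ = Loopless-cancel (unit-≟ R R-unique) (unit-≟ S S-unique)
    (UnitGraph-isFunctional R R-unique) (UnitGraph-isFunctional S S-unique) (begin
      Loopless (UnitGraph R)  ≃⟨ Cl₂≅Loopless R-connected ⟨
      Cl₂ R                   ≃⟨ φ ⟩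
      Cl₂ S                   ≃⟨ Cl₂≅Loopless S-connected ⟩
      Loopless (UnitGraph S)  ∎)
    where open ≅-Reasoning

  connected-Cl₂-×-congˡ : (T : RingData) → InversesUnique T →
                          Cl₂ R ≅ Cl₂ S → Cl₂ (R ×R T) ≅ Cl₂ (S ×R T)
  connected-Cl₂-×-congˡ T T-unique φ = Cl₂-×-congˡ R S T R-unique S-unique T-unique
    connected⇒IdempotentGraph-≅ (Cl₂-≅⇒UnitGraph-≅ φ)

-- The rings ℤ/N

[m+n]%d≡m⇒d∣n : ∀ m n d .{{_ : NonZero d}} → (m + n) % d ≡ m → d ∣ n
[m+n]%d≡m⇒d∣n m n d [m+n]%d≡m = divides ((m + n) / d) (ℕ.+-cancelˡ-≡ m n _ (begin
  m + n                            ≡⟨ m≡m%n+[m/n]*n (m + n) d ⟩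
  (m + n) % d + (m + n) / d ℕ.* d  ≡⟨ cong (_+ (m + n) / d ℕ.* d) [m+n]%d≡m ⟩
  m + (m + n) / d ℕ.* d            ∎))
  where open ≡-Reasoning

prime^k∣m*n⇒∣n : ∀ {p m} → Prime p → ¬ p ∣ m → ∀ k {n} → p ^ k ∣ m ℕ.* n → p ^ k ∣ n
prime^k∣m*n⇒∣n _ _ zero {n} _ = 1∣ n
prime^k∣m*n⇒∣n {p} {m} p-prime p∤m (suc k) {n} p^[1+k]∣mn
  with euclidsLemma m n p-prime (∣-trans (m∣m*n (p ^ k)) p^[1+k]∣mn)
... | inj₁ p∣m = ⊥-elim (p∤m p∣m)
... | inj₂ (divides q refl) = subst (p ℕ.* p ^ k ∣_) (ℕ.*-comm p q) (*-monoʳ-∣ p p^k∣q)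
  where
  instance _ = prime⇒nonZero p-prime
  p^k∣q : p ^ k ∣ q
  p^k∣q = prime^k∣m*n⇒∣n p-prime p∤m k (*-cancelˡ-∣ p (subst (p ℕ.* p ^ k ∣_)
    (trans (sym (ℕ.*-assoc m q p)) (ℕ.*-comm (m ℕ.* q) p)) p^[1+k]∣mn))

prime^k∣m*[1+m] : ∀ {p} → Prime p → ∀ k m → p ^ k ∣ m ℕ.* suc m → p ^ k ∣ m ⊎ p ^ k ∣ suc m
prime^k∣m*[1+m] {p} p-prime k m p^k∣m[1+m] with p ∣? m
... | no  p∤m = inj₂ (prime^k∣m*n⇒∣n p-prime p∤m k p^k∣m[1+m])
... | yes p∣m =
  inj₁ (prime^k∣m*n⇒∣n p-prime p∤1+m k (subst (p ^ k ∣_) (ℕ.*-comm m (suc m)) p^k∣m[1+m]))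
  where
  p∤1+m : ¬ p ∣ suc m
  p∤1+m p∣1+m = nonTrivial⇒≢1 {{prime⇒nonTrivial p-prime}}
    (∣1⇒≡1 (∣m+n∣m⇒∣n (subst (p ∣_) (ℕ.+-comm 1 m) p∣1+m) p∣m))

<∧∣⇒≡0 : ∀ {d} m → m < d → d ∣ m → m ≡ 0
<∧∣⇒≡0 zero    _   _   = refl
<∧∣⇒≡0 (suc m) m<d d∣m = ⊥-elim (>⇒∤ m<d d∣m)

1<prime^n : ∀ {p n} → Prime p → 1 ≤ n → 1 < p ^ n
1<prime^n {p} {suc k} p-prime _ = ℕ.≤-trans (nonTrivial⇒n>1 p) (ℕ.m≤m*n p (p ^ k) {{ℕ.m^n≢0 p k}})
  where
  instance
    _ = prime⇒nonZero p-prime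
    _ = prime⇒nonTrivial p-prime

module ℤ/-Properties (N : ℕ) .{{_ : NonZero N}} where
  open RingData (ℤ/ N)

  toℕ-mod : ∀ m → toℕ (m mod N) ≡ m % N
  toℕ-mod m = toℕ-fromℕ< (m%n<n m N)

  mod-cong : ∀ {m n} → m % N ≡ n % N → m mod N ≡ n mod N
  mod-cong {m} {n} eq = toℕ-injective (trans (toℕ-mod m) (trans eq (sym (toℕ-mod n))))

  toℕ-mod-inverse : ∀ a → toℕ a mod N ≡ a
  toℕ-mod-inverse a = toℕ-injective (trans (toℕ-mod (toℕ a)) (m<n⇒m%n≡m (toℕ<n a)))

  mod-*ˡ : ∀ m a → (m mod N) * a ≡ (m ℕ.* toℕ a) mod N
  mod-*ˡ m a = mod-cong (begin
    toℕ (m mod N) ℕ.* toℕ a % N    ≡⟨ cong (λ x → x ℕ.* toℕ a % N) (toℕ-mod m) ⟩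
    m % N ℕ.* toℕ a % N            ≡⟨ %-distribˡ-* (m % N) (toℕ a) N ⟩
    m % N % N ℕ.* (toℕ a % N) % N  ≡⟨ cong (λ x → x ℕ.* (toℕ a % N) % N) (m%n%n≡m%n m N) ⟩
    m % N ℕ.* (toℕ a % N) % N      ≡⟨ %-distribˡ-* m (toℕ a) N ⟨
    m ℕ.* toℕ a % N                ∎)
    where open ≡-Reasoning

  *-comm : ∀ a b → a * b ≡ b * a
  *-comm a b = cong (_mod N) (ℕ.*-comm (toℕ a) (toℕ b))

  *-assoc : ∀ a b c → (a * b) * c ≡ a * (b * c)
  *-assoc a b c = begin
    (a * b) * c                    ≡⟨ mod-*ˡ (A ℕ.* B) c ⟩
    (A ℕ.* B ℕ.* C) mod N          ≡⟨ cong (_mod N) (ℕ.*-assoc A B C) ⟩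
    (A ℕ.* (B ℕ.* C)) mod N        ≡⟨ cong (_mod N) (ℕ.*-comm A (B ℕ.* C)) ⟩
    (B ℕ.* C ℕ.* A) mod N          ≡⟨ mod-*ˡ (B ℕ.* C) a ⟨
    (b * c) * a                    ≡⟨ *-comm (b * c) a ⟩
    a * (b * c)                    ∎
    where
    open ≡-Reasoning
    A = toℕ a
    B = toℕ b
    C = toℕ c

  *-identityˡ : ∀ a → 1# * a ≡ a
  *-identityˡ a = begin
    1# * a               ≡⟨ mod-*ˡ 1 a ⟩
    (1 ℕ.* toℕ a) mod N  ≡⟨ cong (_mod N) (ℕ.*-identityˡ (toℕ a)) ⟩
    toℕ a mod N          ≡⟨ toℕ-mod-inverse a ⟩
    a                    ∎
    where open ≡-Reasoning

  *-zeroˡ : ∀ a → 0# * a ≡ 0#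
  *-zeroˡ = mod-*ˡ 0

  isMonoid : IsMonoid _≡_ _*_ 1#
  isMonoid = record
    { isSemigroup = record
      { isMagma = record { isEquivalence = isEquivalence ; ∙-cong = cong₂ _*_ }
      ; assoc   = *-assoc
      }
    ; identity = *-identityˡ , λ a → trans (*-comm a 1#) (*-identityˡ a)
    }

  *-zero : Zero _≡_ 0# _*_
  *-zero = *-zeroˡ , λ a → trans (*-comm a 0#) (*-zeroˡ a)

-- (1 + m) * (1 + m) computes to (1 + m) + m * (1 + m), so p ^ n divides m * (1 + m).
m*m%p^n≡m⇒m≡0∨m≡1 : ∀ {p} → Prime p → ∀ n .{{_ : NonZero (p ^ n)}} m →
                     m < p ^ n → m ℕ.* m % p ^ n ≡ m → m ≡ 0 ⊎ m ≡ 1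
m*m%p^n≡m⇒m≡0∨m≡1 _ _ zero _ _ = inj₁ refl
m*m%p^n≡m⇒m≡0∨m≡1 {p} p-prime n (suc m) 1+m<p^n [1+m]²%p^n≡1+m
  with prime^k∣m*[1+m] p-prime n m ([m+n]%d≡m⇒d∣n (suc m) (m ℕ.* suc m) (p ^ n) [1+m]²%p^n≡1+m)
... | inj₁ p^n∣m   = inj₂ (cong suc (<∧∣⇒≡0 m (ℕ.<-trans (ℕ.n<1+n m) 1+m<p^n) p^n∣m))
... | inj₂ p^n∣1+m = ⊥-elim (>⇒∤ 1+m<p^n p^n∣1+m)

module _ {p : ℕ} (p-prime : Prime p) {n : ℕ} (n≥1 : 1 ≤ n) where
  private instance
    p^n≢0 : NonZero (p ^ n)
    p^n≢0 = ℕ.m^n≢0 p n {{prime⇒nonZero p-prime}}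

  open RingData (ℤ/pow p p-prime n)
  open ℤ/-Properties (p ^ n)

  private
    toℕ-1# : toℕ 1# ≡ 1
    toℕ-1# = trans (toℕ-mod 1) (m<n⇒m%n≡m (1<prime^n p-prime n≥1))

    toℕ-0# : toℕ 0# ≡ 0
    toℕ-0# = trans (toℕ-mod 0) (m<n⇒m%n≡m (ℕ.m^n>0 p {{prime⇒nonZero p-prime}} n))

  ℤ/pow-1≢0 : 1# ≢ 0#
  ℤ/pow-1≢0 1≡0 = ℕ.1+n≢0 (trans (sym toℕ-1#) (trans (cong toℕ 1≡0) toℕ-0#))

  ℤ/pow-idempotent⇒0⊎1 : ∀ {e} → e * e ≡ e → e ≡ 0# ⊎ e ≡ 1#
  ℤ/pow-idempotent⇒0⊎1 {e} ee≡e =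
    Sum.map (λ e≡0 → toℕ-injective (trans e≡0 (sym toℕ-0#)))
            (λ e≡1 → toℕ-injective (trans e≡1 (sym toℕ-1#)))
      (m*m%p^n≡m⇒m≡0∨m≡1 p-prime n (toℕ e) (toℕ<n e) (trans (sym (toℕ-mod _)) (cong toℕ ee≡e)))

  ℤ/pow-isConnected : IsConnected (ℤ/pow p p-prime n)
  ℤ/pow-isConnected = record
    { isMonoid       = isMonoid
    ; *-zero         = *-zero
    ; 1≢0            = ℤ/pow-1≢0
    ; idempotent⇒0⊎1 = ℤ/pow-idempotent⇒0⊎1
    }

mainTheorem7 : (p q n m : ℕ) → (pp : Prime p) → (qp : Prime q) → 1 ≤ n → 1 ≤ m →
    Cl₂ (ℤ/pow p pp n) ≅ Cl₂ (ℤ/pow q qp m) →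
    (k : ℕ) → .{{_ : NonZero k}} →
    Cl₂ (ℤ/pow p pp n ×R ℤ/ k) ≅ Cl₂ (ℤ/pow q qp m ×R ℤ/ k)
mainTheorem7 p q n m pp qp n≥1 m≥1 φ k =
  connected-Cl₂-×-congˡ (ℤ/pow-isConnected pp n≥1) (ℤ/pow-isConnected qp m≥1)
    (ℤ/ k) (monoid⇒inversesUnique (ℤ/ k) (ℤ/-Properties.isMonoid k)) φ
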